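{- Let $G$ be a connected graph of order $n\geq 5$, size $m$ (number of edges), minimum degree $\delta$ and vertex-connectivity $\kappa$, and let $k$ be an integer with $\delta\geq k\geq 2$. (a) If $m \geq \frac12 n(n-1) - (\delta-k+2)(n-\delta-1)$, then $\kappa\geq k$, unless $G\cong K_{k-1}\vee (K_{\delta-k+2}\cup K_{n-\delta-1})$. (b) If $n\geq \frac12(k+1)(\delta-k+2)+(\delta+2)$ and $m \geq \frac12 n(n-1) - \frac12(\delta-k+2)(2n-2\delta+k-3)$, then $\kappa\geq k$, unless $G$ is isomorphic to a subgraph of $K_{k-1}\vee (K_{\delta-k+2}\cup K_{n-\delta-1})$.
   Context: All graphs are finite, simple and undirected. The vertex-connectivity $\kappa(G)$ of a connected non-complete graph is the minimum size of a vertex set whose removal disconnects $G$, and $\kappa(K_n)=n-1$. $K_r$ denotes the complete graph on $r$ vertices, $G_1\cup G_2$ denotes the disjoint union, and $G_1\vee G_2$ denotes the join, obtained from $G_1\cup G_2$ by joining every vertex of $G_1$ to every vertex of $G_2$. -}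

module Defs where

open import Data.Bool using (Bool; true; false; not; _∧_)
open import Data.Nat using (ℕ; zero; suc; _+_; _*_; _∸_; _≤_; _≡ᵇ_; _<ᵇ_)
open import Data.Fin using (Fin; toℕ; splitAt)
open import Data.Fin.Subset using (Subset; _∉_; ∣_∣) renaming (⊥ to ∅)
open import Data.Sum using (_⊎_; inj₁; inj₂)
open import Data.Product using (Σ; _×_; ∃; ∃-syntax; _,_)
open import Relation.Nullary using (¬_)
open import Relation.Binary.PropositionalEquality using (_≡_; _≢_; refl)
open import Function.Bundles using (_↔_; Inverse; _↣_; Injection)

record Graph (n : ℕ) : Set where
  field
    Adj    : Fin n → Fin n → Bool
    sym    : ∀ u v → Adj u v ≡ Adj v u
    irrefl : ∀ u → Adj u u ≡ false
open Graph public

countF : ∀ {n} → (Fin n → Bool) → ℕ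
countF {zero}  f = 0
countF {suc n} f = (if' f Fin.zero) + countF (λ i → f (Fin.suc i))
  where
  if' : (Fin (suc n) → Bool) → Fin (suc n) → ℕ
  if' g i with g i
  ... | true  = 1
  ... | false = 0

sumF : ∀ {n} → (Fin n → ℕ) → ℕ
sumF {zero}  f = 0
sumF {suc n} f = f Fin.zero + sumF (λ i → f (Fin.suc i))

deg : ∀ {n} → Graph n → Fin n → ℕ
deg G u = countF (Adj G u)

-- size (number of edges): unordered pairs {u,v} with v < u adjacent
size : ∀ {n} → Graph n → ℕ
size G = sumF (λ u → countF (λ v → Adj G u v ∧ (toℕ v <ᵇ toℕ u)))

IsMinDegree : ∀ {n} → Graph n → ℕ → Set
IsMinDegree G δ = (∀ u → δ ≤ deg G u) × (∃[ u ] deg G u ≡ δ)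

data Walk {n} (G : Graph n) (S : Subset n) : Fin n → Fin n → Set where
  here : ∀ {u} → Walk G S u u
  step : ∀ {u w v} → Adj G u w ≡ true → w ∉ S → Walk G S w v → Walk G S u v

Connected : ∀ {n} → Graph n → Set
Connected G = ∀ u v → Walk G ∅ u v

Disconnects : ∀ {n} → Graph n → Subset n → Set
Disconnects G S = Σ _ λ u → Σ _ λ v → u ∉ S × v ∉ S × ¬ Walk G S u v

IsComplete : ∀ {n} → Graph n → Set
IsComplete G = ∀ u v → u ≢ v → Adj G u v ≡ true

IsVertexConnectivity : ∀ {n} → Graph n → ℕ → Set
IsVertexConnectivity {n} G κ =
  (IsComplete G × κ ≡ n ∸ 1)
  ⊎ (¬ IsComplete G
     × (∃[ S ] (Disconnects G S × ∣ S ∣ ≡ κ))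
     × (∀ S → Disconnects G S → κ ≤ ∣ S ∣))

_≅_ : ∀ {n n'} → Graph n → Graph n' → Set
_≅_ {n} {n'} G H =
  Σ (Fin n ↔ Fin n') λ f →
    ∀ u v → Adj G u v ≡ Adj H (Inverse.to f u) (Inverse.to f v)

_≲_ : ∀ {n n'} → Graph n → Graph n' → Set
_≲_ {n} {n'} G H =
  Σ (Fin n ↣ Fin n') λ f →
    ∀ u v → Adj G u v ≡ true → Adj H (Injection.to f u) (Injection.to f v) ≡ true

private
  ≡ᵇ-sym : ∀ a b → (a ≡ᵇ b) ≡ (b ≡ᵇ a)
  ≡ᵇ-sym zero zero = refl
  ≡ᵇ-sym zero (suc b) = refl
  ≡ᵇ-sym (suc a) zero = refl
  ≡ᵇ-sym (suc a) (suc b) = ≡ᵇ-sym a b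

  ≡ᵇ-refl : ∀ a → (a ≡ᵇ a) ≡ true
  ≡ᵇ-refl zero = refl
  ≡ᵇ-refl (suc a) = ≡ᵇ-refl a

K : (r : ℕ) → Graph r
K r = record
  { Adj = λ u v → not (toℕ u ≡ᵇ toℕ v)
  ; sym = λ u v → cong' (≡ᵇ-sym (toℕ u) (toℕ v))
  ; irrefl = λ u → cong' (≡ᵇ-refl (toℕ u))
  }
  where
  cong' : ∀ {a b} → a ≡ b → not a ≡ not b
  cong' refl = refl

private
  combine : ∀ {p q} → Bool → Graph p → Graph q →
            Fin (p + q) → Fin (p + q) → Bool
  combine {p} c G H u v with splitAt p u | splitAt p v
  ... | inj₁ a | inj₁ b = Adj G a b
  ... | inj₂ a | inj₂ b = Adj H a b
  ... | inj₁ _ | inj₂ _ = c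
  ... | inj₂ _ | inj₁ _ = c

  combine-sym : ∀ {p q} c (G : Graph p) (H : Graph q) u v →
                combine c G H u v ≡ combine c G H v u
  combine-sym {p} c G H u v with splitAt p u | splitAt p v
  ... | inj₁ a | inj₁ b = sym G a b
  ... | inj₂ a | inj₂ b = sym H a b
  ... | inj₁ _ | inj₂ _ = refl
  ... | inj₂ _ | inj₁ _ = refl

  combine-irrefl : ∀ {p q} c (G : Graph p) (H : Graph q) u →
                   combine c G H u u ≡ false
  combine-irrefl {p} c G H u with splitAt p u
  ... | inj₁ a = irrefl G a
  ... | inj₂ a = irrefl H a

_∪ᴳ_ : ∀ {p q} → Graph p → Graph q → Graph (p + q)
G ∪ᴳ H = record
  { Adj = combine false G H
  ; sym = combine-sym false G H
  ; irrefl = combine-irrefl false G H }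

_∨ᴳ_ : ∀ {p q} → Graph p → Graph q → Graph (p + q)
G ∨ᴳ H = record
  { Adj = combine true G H
  ; sym = combine-sym true G H
  ; irrefl = combine-irrefl true G H }

module Submission where

-- If κ < k, take a minimum vertex cut S and split G - S into the component X of some vertex and
-- the rest Y. There are no X-Y edges, s = |S| ≤ k - 1, and the minimum degree forces
-- s + |X| ≥ δ + 1 and s + |Y| ≥ δ + 1. Counting, for every vertex, its neighbours together with
-- the vertices on the opposite shore gives 2m + 2|X||Y| ≤ n(n - 1), and under the size
-- constraints |X||Y| ≥ (δ - k + 2)(n - δ - 1), with equality only if s = k - 1 and one shore
-- has δ - k + 2 vertices. In (a) the edge hypothesis then forces equality throughout, so G is
-- the complete graph minus the X-Y edges, i.e. K_{k-1} ∨ (K_{δ-k+2} ∪ K_{n-δ-1}). In (b), if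
-- s + |X| and s + |Y| both exceed δ + 1, a vertex of degree δ leaves slack in the count, and the
-- resulting strict bound contradicts the hypotheses; otherwise one shore is small, and moving
-- k - 1 - s of its vertices into S embeds G into K_{k-1} ∨ (K_{δ-k+2} ∪ K_{n-δ-1}).

open import Defs hiding (sym)
open import Algebra.Properties.CommutativeSemigroup using (interchange)
open import Data.Bool using (Bool; true; false; not; _∧_; T)
open import Data.Empty using (⊥; ⊥-elim)
open import Data.Fin using (Fin; toℕ; fromℕ<; punchOut; _↑ˡ_; _↑ʳ_; splitAt) renaming (zero to fz; suc to fs)
import Data.Fin.Properties as Fin
open import Data.Fin.Subset using (Subset; _∉_; ∣_∣)
open import Data.List using (_∷_; [])
open import Data.Nat using (ℕ; zero; suc; _+_; _*_; _∸_; _≤_; _<_; _≤?_; _<ᵇ_; _≡ᵇ_; z≤n; s≤s)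
open import Data.Nat.Properties
open import Data.Nat.Tactic.RingSolver using (solve-∀; solve)
open import Data.Product using (Σ; _×_; _,_; proj₁; proj₂)
open import Data.Sum using (_⊎_; inj₁; inj₂)
open import Data.Vec using (lookup)
import Data.Vec as Vec
open import Data.Vec.Properties using (lookup⇒[]=; []=⇒lookup)
open import Function using (_∘_)
open import Function.Bundles using (_↔_; Inverse; mk↔ₛ′; mk↣)
open import Relation.Binary using (tri<; tri≈; tri>)
open import Relation.Binary.PropositionalEquality
open import Relation.Nullary using (¬_; Dec; yes; no)
open import Relation.Nullary.Decidable using (⌊_⌋; ¬¬-excluded-middle; decidable-stable)

-- Finite sums and counting

𝟙 : Bool → ℕ
𝟙 true  = 1
𝟙 false = 0

𝟙≤1 : ∀ b → 𝟙 b ≤ 1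
𝟙≤1 true  = ≤-refl
𝟙≤1 false = z≤n

sumF-cong : ∀ {n} {f g : Fin n → ℕ} → (∀ i → f i ≡ g i) → sumF f ≡ sumF g
sumF-cong {zero}  f≗g = refl
sumF-cong {suc n} f≗g = cong₂ _+_ (f≗g fz) (sumF-cong (f≗g ∘ fs))

sumF-distrib-+ : ∀ {n} (f g : Fin n → ℕ) → sumF (λ i → f i + g i) ≡ sumF f + sumF g
sumF-distrib-+ {zero}  f g = refl
sumF-distrib-+ {suc n} f g = begin
  f fz + g fz + sumF (λ i → f (fs i) + g (fs i))
    ≡⟨ cong (f fz + g fz +_) (sumF-distrib-+ (f ∘ fs) (g ∘ fs)) ⟩
  f fz + g fz + (sumF (f ∘ fs) + sumF (g ∘ fs))
    ≡⟨ interchange +-commutativeSemigroup (f fz) (g fz) _ _ ⟩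
  f fz + sumF (f ∘ fs) + (g fz + sumF (g ∘ fs)) ∎
  where open ≡-Reasoning

sumF-const : ∀ n c → sumF {n} (λ _ → c) ≡ n * c
sumF-const zero    c = refl
sumF-const (suc n) c = cong (c +_) (sumF-const n c)

sumF-*ʳ : ∀ {n} (f : Fin n → ℕ) c → sumF (λ i → f i * c) ≡ sumF f * c
sumF-*ʳ {zero}  f c = refl
sumF-*ʳ {suc n} f c =
  trans (cong (f fz * c +_) (sumF-*ʳ (f ∘ fs) c)) (sym (*-distribʳ-+ c (f fz) _))

sumF-comm : ∀ {m n} (h : Fin m → Fin n → ℕ) →
  sumF (λ i → sumF (h i)) ≡ sumF (λ j → sumF (λ i → h i j))
sumF-comm {zero}  {n} h = sym (trans (sumF-const n 0) (*-zeroʳ n))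
sumF-comm {suc m} {n} h =
  trans (cong (sumF (h fz) +_) (sumF-comm (h ∘ fs)))
        (sym (sumF-distrib-+ (h fz) (λ j → sumF (λ i → h (fs i) j))))

sumF-mono-≤ : ∀ {n} {f g : Fin n → ℕ} → (∀ i → f i ≤ g i) → sumF f ≤ sumF g
sumF-mono-≤ {zero}  f≤g = z≤n
sumF-mono-≤ {suc n} f≤g = +-mono-≤ (f≤g fz) (sumF-mono-≤ (f≤g ∘ fs))

sumF-mono-< : ∀ {n} {f g : Fin n → ℕ} → (∀ i → f i ≤ g i) → ∀ j → f j < g j → sumF f < sumF g
sumF-mono-< f≤g fz     fj<gj = +-mono-<-≤ fj<gj (sumF-mono-≤ (f≤g ∘ fs))
sumF-mono-< f≤g (fs j) fj<gj = +-mono-≤-< (f≤g fz) (sumF-mono-< (f≤g ∘ fs) j fj<gj)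

sumF-mono-≤-tight : ∀ {n} {f g : Fin n → ℕ} → (∀ i → f i ≤ g i) → sumF g ≤ sumF f →
  ∀ i → f i ≡ g i
sumF-mono-≤-tight f≤g Σg≤Σf i with m≤n⇒m<n∨m≡n (f≤g i)
... | inj₁ fi<gi = ⊥-elim (<⇒≱ (sumF-mono-< f≤g i fi<gi) Σg≤Σf)
... | inj₂ fi≡gi = fi≡gi

count : ∀ {n} → (Fin n → Bool) → ℕ
count P = sumF (𝟙 ∘ P)

countF≡count : ∀ {n} (P : Fin n → Bool) → countF P ≡ count P
countF≡count {zero}  P = refl
countF≡count {suc n} P with P fz
... | true  = cong suc (countF≡count (P ∘ fs))
... | false = countF≡count (P ∘ fs)

count-false : ∀ n → count {n} (λ _ → false) ≡ 0
count-false n = trans (sumF-const n 0) (*-zeroʳ n)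

_≟ᵇ_ : ∀ {n} → Fin n → Fin n → Bool
i ≟ᵇ j = ⌊ i Fin.≟ j ⌋

count-≟ᵇ : ∀ {n} (x : Fin n) → count (_≟ᵇ x) ≡ 1
count-≟ᵇ {suc n} fz     = cong suc (count-false n)
count-≟ᵇ {suc n} (fs x) = trans (sumF-cong λ i → cong 𝟙 (sucs≟ i)) (count-≟ᵇ x)
  where
  sucs≟ : ∀ i → (fs i ≟ᵇ fs x) ≡ (i ≟ᵇ x)
  sucs≟ i with i Fin.≟ x
  ... | yes refl = refl
  ... | no  _    = refl

module _ {n} (f g : Fin n → Bool) (x : Fin n) (fx : f x ≡ false) (gx : g x ≡ false)
         (disjoint : ∀ y → f y ≡ true → g y ≡ false) where

  private
    h : Fin n → ℕ
    h y = 𝟙 (f y) + 𝟙 (g y) + 𝟙 (y ≟ᵇ x)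

    h≤1 : ∀ y → h y ≤ 1
    h≤1 y with y Fin.≟ x
    ... | yes refl rewrite fx | gx = ≤-refl
    ... | no  _ with f y in fy
    ...   | true  rewrite disjoint y fy = ≤-refl
    ...   | false = +-monoˡ-≤ 0 (𝟙≤1 (g y))

    Σh : sumF h ≡ count f + count g + 1
    Σh = begin
      sumF h
        ≡⟨ sumF-distrib-+ (λ y → 𝟙 (f y) + 𝟙 (g y)) (𝟙 ∘ (_≟ᵇ x)) ⟩
      sumF (λ y → 𝟙 (f y) + 𝟙 (g y)) + count (_≟ᵇ x)
        ≡⟨ cong (_ +_) (count-≟ᵇ x) ⟩
      sumF (λ y → 𝟙 (f y) + 𝟙 (g y)) + 1
        ≡⟨ cong (_+ 1) (sumF-distrib-+ (𝟙 ∘ f) (𝟙 ∘ g)) ⟩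
      count f + count g + 1 ∎
      where open ≡-Reasoning

    Σ1 : sumF {n} (λ _ → 1) ≡ n
    Σ1 = trans (sumF-const n 1) (*-identityʳ n)

  count-disjoint-≤ : count f + count g + 1 ≤ n
  count-disjoint-≤ = subst₂ _≤_ Σh Σ1 (sumF-mono-≤ h≤1)

  count-disjoint-tight : n ≤ count f + count g + 1 → ∀ y → y ≢ x → g y ≡ false → f y ≡ true
  count-disjoint-tight n≤ y y≢x gy = f-true (sumF-mono-≤-tight h≤1 (subst₂ _≤_ (sym Σ1) (sym Σh) n≤) y)
    where
    f-true : h y ≡ 1 → f y ≡ true
    f-true hy≡1 rewrite gy with y Fin.≟ x | f y
    ... | yes y≡x | _     = ⊥-elim (y≢x y≡x)
    ... | no  _   | true  = refl
    ... | no  _   | false = ⊥-elim (0≢1+n hy≡1)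

-- Degrees, edges and walks

deg≡count : ∀ {n} (G : Graph n) u → deg G u ≡ count (Adj G u)
deg≡count G u = countF≡count (Adj G u)

deg≤n∸1 : ∀ {n} (G : Graph n) u → deg G u ≤ n ∸ 1
deg≤n∸1 {n} G u = m+n≤o⇒m≤o∸n (deg G u) (subst (λ d → d + 1 ≤ n) deg≡d
  (count-disjoint-≤ (Adj G u) (λ _ → false) u (irrefl G u) refl (λ _ _ → refl)))
  where
  deg≡d : count (Adj G u) + count {n} (λ _ → false) ≡ deg G u
  deg≡d = trans (cong₂ _+_ (sym (deg≡count G u)) (count-false n)) (+-identityʳ _)

_<ᶠ_ : ∀ {n} → Fin n → Fin n → Bool
u <ᶠ v = toℕ u <ᵇ toℕ v

<ᵇ-true : ∀ {m n} → m < n → (m <ᵇ n) ≡ true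
<ᵇ-true {m} {n} m<n with (m <ᵇ n) | <⇒<ᵇ m<n
... | true | _ = refl

<ᵇ-false : ∀ {m n} → ¬ m < n → (m <ᵇ n) ≡ false
<ᵇ-false {m} {n} m≮n with (m <ᵇ n) in eq
... | true  = ⊥-elim (m≮n (<ᵇ⇒< m n (subst T (sym eq) _)))
... | false = refl

adj-split : ∀ {n} (G : Graph n) u v →
  𝟙 (Adj G u v) ≡ 𝟙 (Adj G u v ∧ v <ᶠ u) + 𝟙 (Adj G v u ∧ u <ᶠ v)
adj-split G u v rewrite Graph.sym G v u with Adj G u v in uv
... | false = refl
... | true with <-cmp (toℕ u) (toℕ v)
...   | tri< u<v _ u≯v rewrite <ᵇ-true u<v | <ᵇ-false u≯v = refl
...   | tri> u≮v _ u>v rewrite <ᵇ-true u>v | <ᵇ-false u≮v = refl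
...   | tri≈ _ u≡v _ with Fin.toℕ-injective u≡v
...     | refl with () ← trans (sym uv) (irrefl G u)

handshake : ∀ {n} (G : Graph n) → sumF (deg G) ≡ 2 * size G
handshake {n} G = begin
  sumF (deg G)
    ≡⟨ sumF-cong (λ u → trans (deg≡count G u) (sumF-cong (adj-split G u))) ⟩
  sumF (λ u → sumF (λ v → P u v + P v u))
    ≡⟨ sumF-cong (λ u → sumF-distrib-+ (P u) (λ v → P v u)) ⟩
  sumF (λ u → sumF (P u) + sumF (λ v → P v u))
    ≡⟨ sumF-distrib-+ (λ u → sumF (P u)) _ ⟩
  sumF (λ u → sumF (P u)) + sumF (λ u → sumF (λ v → P v u))
    ≡⟨ cong (sumF (λ u → sumF (P u)) +_) (sym (sumF-comm P)) ⟩
  sumF (λ u → sumF (P u)) + sumF (λ u → sumF (P u))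
    ≡⟨ cong₂ _+_ size≡ (trans size≡ (sym (+-identityʳ _))) ⟩
  2 * size G ∎
  where
  open ≡-Reasoning
  P : Fin n → Fin n → ℕ
  P u v = 𝟙 (Adj G u v ∧ v <ᶠ u)
  size≡ : sumF (λ u → sumF (P u)) ≡ size G
  size≡ = sumF-cong (λ u → sym (countF≡count (λ v → Adj G u v ∧ v <ᶠ u)))

∣S∣≡count : ∀ {n} (S : Subset n) → ∣ S ∣ ≡ count (lookup S)
∣S∣≡count Vec.[]          = refl
∣S∣≡count (true Vec.∷ S)  = cong suc (∣S∣≡count S)
∣S∣≡count (false Vec.∷ S) = ∣S∣≡count S

lookup-∉ : ∀ {n} {S : Subset n} {x} → x ∉ S → lookup S x ≡ false
lookup-∉ {S = S} {x} x∉S with lookup S x in eq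
... | true  = ⊥-elim (x∉S (lookup⇒[]= x S eq))
... | false = refl

∉-lookup : ∀ {n} {S : Subset n} {x} → lookup S x ≡ false → x ∉ S
∉-lookup {S = S} {x} eq x∈S with () ← trans (sym eq) ([]=⇒lookup x∈S)

walk-snoc : ∀ {n} {G : Graph n} {S u x y} →
  Walk G S u x → Adj G x y ≡ true → y ∉ S → Walk G S u y
walk-snoc here           xy y∉S = step xy y∉S here
walk-snoc (step uw w∉S p) xy y∉S = step uw w∉S (walk-snoc p xy y∉S)

¬¬-decidable : ∀ {n} (P : Fin n → Set) → ¬ ¬ (∀ x → Dec (P x))
¬¬-decidable {zero}  P k = k λ ()
¬¬-decidable {suc n} P k = ¬¬-excluded-middle λ P0? →
  ¬¬-decidable (P ∘ fs) λ Ps? → k λ { fz → P0? ; (fs x) → Ps? x }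

choose-subset : ∀ {n} (P : Fin n → Bool) d → d ≤ count P →
  Σ (Fin n → Bool) λ Q → (∀ u → Q u ≡ true → P u ≡ true) × count Q ≡ d
choose-subset {zero}  P zero    _ = (λ _ → false) , (λ _ ()) , refl
choose-subset {suc n} P d       d≤ with P fz in P0
choose-subset {suc n} P d       d≤ | false with choose-subset (P ∘ fs) d d≤
... | Q , Q⊆P , ∣Q∣ = (λ { fz → false ; (fs i) → Q i }) , (λ { fz () ; (fs i) → Q⊆P i }) , ∣Q∣
choose-subset {suc n} P zero    _  | true = (λ _ → false) , (λ _ ()) , count-false (suc n)
choose-subset {suc n} P (suc d) (s≤s d≤) | true with choose-subset (P ∘ fs) d d≤
... | Q , Q⊆P , ∣Q∣ = (λ { fz → true ; (fs i) → Q i }) , (λ { fz _ → P0 ; (fs i) → Q⊆P i }) , cong suc ∣Q∣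

-- Enumerating finite sets

module _ {n} (P : Fin n → Bool) where

  rank : Fin n → ℕ
  rank u = count (λ y → P y ∧ y <ᶠ u)

  rank<count : ∀ u → P u ≡ true → rank u < count P
  rank<count u Pu = sumF-mono-< below u at-u
    where
    below : ∀ y → 𝟙 (P y ∧ y <ᶠ u) ≤ 𝟙 (P y)
    below y with P y
    ... | true  = 𝟙≤1 _
    ... | false = z≤n
    at-u : 𝟙 (P u ∧ u <ᶠ u) < 𝟙 (P u)
    at-u rewrite Pu | <ᵇ-false (n≮n (toℕ u)) = ≤-refl

  rank-strictMono : ∀ u v → P u ≡ true → toℕ u < toℕ v → rank u < rank v
  rank-strictMono u v Pu u<v = sumF-mono-< below u at-u
    where
    below : ∀ y → 𝟙 (P y ∧ y <ᶠ u) ≤ 𝟙 (P y ∧ y <ᶠ v)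
    below y with P y | y <ᶠ u in y<u
    ... | false | _     = z≤n
    ... | true  | false = z≤n
    ... | true  | true  rewrite <ᵇ-true (<-trans (<ᵇ⇒< (toℕ y) (toℕ u) (subst T (sym y<u) _)) u<v) = ≤-refl
    at-u : 𝟙 (P u ∧ u <ᶠ u) < 𝟙 (P u ∧ u <ᶠ v)
    at-u rewrite Pu | <ᵇ-false (n≮n (toℕ u)) | <ᵇ-true u<v = ≤-refl

  rank-injective : ∀ u v → P u ≡ true → P v ≡ true → rank u ≡ rank v → u ≡ v
  rank-injective u v Pu Pv ru≡rv with <-cmp (toℕ u) (toℕ v)
  ... | tri< u<v _ _ = ⊥-elim (<-irrefl ru≡rv (rank-strictMono u v Pu u<v))
  ... | tri≈ _ u≡v _ = Fin.toℕ-injective u≡v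
  ... | tri> _ _ u>v = ⊥-elim (<-irrefl (sym ru≡rv) (rank-strictMono v u Pv u>v))

  index : ∀ u → P u ≡ true → Fin (count P)
  index u Pu = fromℕ< (rank<count u Pu)

  index-injective : ∀ u v (Pu : P u ≡ true) (Pv : P v ≡ true) → index u Pu ≡ index v Pv → u ≡ v
  index-injective u v Pu Pv eq = rank-injective u v Pu Pv (begin
    rank u                 ≡⟨ sym (Fin.toℕ-fromℕ< _) ⟩
    toℕ (index u Pu)       ≡⟨ cong toℕ eq ⟩
    toℕ (index v Pv)       ≡⟨ Fin.toℕ-fromℕ< _ ⟩
    rank v                 ∎)
    where open ≡-Reasoning

injective⇒surjective : ∀ {m} (f : Fin m → Fin m) → (∀ u v → f u ≡ f v → u ≡ v) →
  ∀ j → Σ (Fin m) λ i → f i ≡ j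
injective⇒surjective f f-inj j with Fin.any? (λ i → f i Fin.≟ j)
... | yes hit = hit
injective⇒surjective {suc m} f f-inj j | no miss =
  ⊥-elim (1+n≰n (Fin.injective⇒≤ {f = g} g-inj))
  where
  g : Fin (suc m) → Fin m
  g i = punchOut {i = j} {j = f i} (λ j≡fi → miss (i , sym j≡fi))
  g-inj : ∀ {a b} → g a ≡ g b → a ≡ b
  g-inj {a} {b} eq = f-inj a b (Fin.punchOut-injective {i = j} _ _ eq)

injective⇒↔ : ∀ {m m'} → m ≡ m' → (f : Fin m → Fin m') → (∀ u v → f u ≡ f v → u ≡ v) →
  Σ (Fin m ↔ Fin m') λ e → ∀ u → Inverse.to e u ≡ f u
injective⇒↔ {m} refl f f-inj =
  mk↔ₛ′ f f⁻¹ (λ j → proj₂ (surj j)) (λ u → f-inj _ _ (proj₂ (surj (f u)))) , λ _ → refl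
  where
  surj : ∀ j → Σ (Fin m) λ i → f i ≡ j
  surj = injective⇒surjective f f-inj
  f⁻¹ : Fin m → Fin m
  f⁻¹ j = proj₁ (surj j)

-- The join K_s ∨ (K_x ∪ K_y)

Join : ∀ s x y → Graph (s + (x + y))
Join s x y = K s ∨ᴳ (K x ∪ᴳ K y)

↑ˡ≢↑ʳ : ∀ {m n} (i : Fin m) (j : Fin n) → i ↑ˡ n ≢ m ↑ʳ j
↑ˡ≢↑ʳ {m} {n} i j eq
  with () ← trans (sym (Fin.splitAt-↑ˡ m i n)) (trans (cong (splitAt m) eq) (Fin.splitAt-↑ʳ m n j))

module JoinVertices (s x y : ℕ) where

  mid : Fin s → Fin (s + (x + y))
  mid i = i ↑ˡ (x + y)

  lft : Fin x → Fin (s + (x + y))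
  lft i = s ↑ʳ (i ↑ˡ y)

  rgt : Fin y → Fin (s + (x + y))
  rgt i = s ↑ʳ (x ↑ʳ i)

  private
    split-mid : ∀ i → splitAt s (mid i) ≡ inj₁ i
    split-mid i = Fin.splitAt-↑ˡ s i (x + y)
    split-shore : ∀ j → splitAt s (s ↑ʳ j) ≡ inj₂ j
    split-shore = Fin.splitAt-↑ʳ s (x + y)

  adj-mid-mid : ∀ i j → Adj (Join s x y) (mid i) (mid j) ≡ not (toℕ i ≡ᵇ toℕ j)
  adj-mid-mid i j rewrite split-mid i | split-mid j = refl

  adj-mid-shore : ∀ i j → Adj (Join s x y) (mid i) (s ↑ʳ j) ≡ true
  adj-mid-shore i j rewrite split-mid i | split-shore j = refl

  adj-left-left : ∀ i j → Adj (Join s x y) (lft i) (lft j) ≡ not (toℕ i ≡ᵇ toℕ j)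
  adj-left-left i j rewrite split-shore (i ↑ˡ y) | split-shore (j ↑ˡ y)
    | Fin.splitAt-↑ˡ x i y | Fin.splitAt-↑ˡ x j y = refl

  adj-right-right : ∀ i j → Adj (Join s x y) (rgt i) (rgt j) ≡ not (toℕ i ≡ᵇ toℕ j)
  adj-right-right i j rewrite split-shore (x ↑ʳ i) | split-shore (x ↑ʳ j)
    | Fin.splitAt-↑ʳ x y i | Fin.splitAt-↑ʳ x y j = refl

  adj-left-right : ∀ i j → Adj (Join s x y) (lft i) (rgt j) ≡ false
  adj-left-right i j rewrite split-shore (i ↑ˡ y) | split-shore (x ↑ʳ j)
    | Fin.splitAt-↑ˡ x i y | Fin.splitAt-↑ʳ x y j = refl

data Side : Set where
  middle left right : Side

_==_ : Side → Side → Bool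
middle == middle = true
left   == left   = true
right  == right  = true
_      == _      = false

==-refl : ∀ c → (c == c) ≡ true
==-refl middle = refl
==-refl left   = refl
==-refl right  = refl

==⇒≡ : ∀ {c d} → (c == d) ≡ true → c ≡ d
==⇒≡ {middle} {middle} _ = refl
==⇒≡ {left}   {left}   _ = refl
==⇒≡ {right}  {right}  _ = refl

crosses : Side → Side → Bool
crosses left  right = true
crosses right left  = true
crosses _     _     = false

module Labelling {n} (side : Fin n → Side) where

  _∈ˢ_ : Fin n → Side → Bool
  u ∈ˢ c = side u == c

  ∣_∣ˢ : Side → ℕ
  ∣ c ∣ˢ = count (_∈ˢ c)

  ∣∣ˢ-sum : ∣ middle ∣ˢ + (∣ left ∣ˢ + ∣ right ∣ˢ) ≡ n
  ∣∣ˢ-sum = begin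
    ∣ middle ∣ˢ + (∣ left ∣ˢ + ∣ right ∣ˢ)
      ≡⟨ cong (∣ middle ∣ˢ +_) (sym (sumF-distrib-+ (𝟙 ∘ is left) (𝟙 ∘ is right))) ⟩
    ∣ middle ∣ˢ + sumF (λ u → 𝟙 (is left u) + 𝟙 (is right u))
      ≡⟨ sym (sumF-distrib-+ (𝟙 ∘ is middle) _) ⟩
    sumF (λ u → 𝟙 (is middle u) + (𝟙 (is left u) + 𝟙 (is right u)))
      ≡⟨ sumF-cong (λ u → one-side (side u)) ⟩
    sumF {n} (λ _ → 1)
      ≡⟨ trans (sumF-const n 1) (*-identityʳ n) ⟩
    n ∎
    where
    open ≡-Reasoning
    is : Side → Fin n → Bool
    is c u = u ∈ˢ c
    one-side : ∀ c → 𝟙 (c == middle) + (𝟙 (c == left) + 𝟙 (c == right)) ≡ 1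
    one-side middle = refl
    one-side left   = refl
    one-side right  = refl

  open JoinVertices ∣ middle ∣ˢ ∣ left ∣ˢ ∣ right ∣ˢ

  private
    position : ∀ c u → side u ≡ c → Fin ∣ c ∣ˢ
    position c u e = index (_∈ˢ c) u (trans (cong (_== c) e) (==-refl c))

    position-injective : ∀ c {u v} (e : side u ≡ c) (e' : side v ≡ c) →
      position c u e ≡ position c v e' → u ≡ v
    position-injective c {u} {v} e e' =
      index-injective (_∈ˢ c) u v (trans (cong (_== c) e) (==-refl c)) (trans (cong (_== c) e') (==-refl c))

    positions-differ : ∀ c {u v} (e : side u ≡ c) (e' : side v ≡ c) → u ≢ v →
      not (toℕ (position c u e) ≡ᵇ toℕ (position c v e')) ≡ true
    positions-differ c {u} {v} e e' u≢v with toℕ (position c u e) ≡ᵇ toℕ (position c v e') in eq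
    ... | false = refl
    ... | true  = ⊥-elim (u≢v (position-injective c e e' (Fin.toℕ-injective (≡ᵇ⇒≡ _ _ (subst T (sym eq) _)))))

    place : ∀ u c → side u ≡ c → Fin (∣ middle ∣ˢ + (∣ left ∣ˢ + ∣ right ∣ˢ))
    place u middle e = mid (position middle u e)
    place u left   e = lft (position left u e)
    place u right  e = rgt (position right u e)

  canonical : Fin n → Fin (∣ middle ∣ˢ + (∣ left ∣ˢ + ∣ right ∣ˢ))
  canonical u = place u (side u) refl

  Joinˢ : Graph (∣ middle ∣ˢ + (∣ left ∣ˢ + ∣ right ∣ˢ))
  Joinˢ = Join ∣ middle ∣ˢ ∣ left ∣ˢ ∣ right ∣ˢ

  private
    place-injective : ∀ u v c d (e : side u ≡ c) (e' : side v ≡ d) → place u c e ≡ place v d e' → u ≡ v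
    place-injective u v middle middle e e' eq = position-injective middle e e' (Fin.↑ˡ-injective _ _ _ eq)
    place-injective u v middle left   e e' eq = ⊥-elim (↑ˡ≢↑ʳ _ _ eq)
    place-injective u v middle right  e e' eq = ⊥-elim (↑ˡ≢↑ʳ _ _ eq)
    place-injective u v left   middle e e' eq = ⊥-elim (↑ˡ≢↑ʳ _ _ (sym eq))
    place-injective u v left   left   e e' eq =
      position-injective left e e' (Fin.↑ˡ-injective _ _ _ (Fin.↑ʳ-injective ∣ middle ∣ˢ _ _ eq))
    place-injective u v left   right  e e' eq = ⊥-elim (↑ˡ≢↑ʳ _ _ (Fin.↑ʳ-injective ∣ middle ∣ˢ _ _ eq))
    place-injective u v right  middle e e' eq = ⊥-elim (↑ˡ≢↑ʳ _ _ (sym eq))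
    place-injective u v right  left   e e' eq = ⊥-elim (↑ˡ≢↑ʳ _ _ (sym (Fin.↑ʳ-injective ∣ middle ∣ˢ _ _ eq)))
    place-injective u v right  right  e e' eq =
      position-injective right e e' (Fin.↑ʳ-injective ∣ left ∣ˢ _ _ (Fin.↑ʳ-injective ∣ middle ∣ˢ _ _ eq))

    place-adj : ∀ u v c d (e : side u ≡ c) (e' : side v ≡ d) → u ≢ v → crosses c d ≡ false →
      Adj Joinˢ (place u c e) (place v d e') ≡ true
    place-adj u v middle middle e e' u≢v _ = trans (adj-mid-mid _ _) (positions-differ middle e e' u≢v)
    place-adj u v middle left   e e' u≢v _ = adj-mid-shore _ _
    place-adj u v middle right  e e' u≢v _ = adj-mid-shore _ _
    place-adj u v left   middle e e' u≢v _ = trans (Graph.sym Joinˢ _ _) (adj-mid-shore _ _)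
    place-adj u v left   left   e e' u≢v _ = trans (adj-left-left _ _) (positions-differ left e e' u≢v)
    place-adj u v right  middle e e' u≢v _ = trans (Graph.sym Joinˢ _ _) (adj-mid-shore _ _)
    place-adj u v right  right  e e' u≢v _ = trans (adj-right-right _ _) (positions-differ right e e' u≢v)

    place-nonadj : ∀ u v c d (e : side u ≡ c) (e' : side v ≡ d) → crosses c d ≡ true →
      Adj Joinˢ (place u c e) (place v d e') ≡ false
    place-nonadj u v left  right e e' _ = adj-left-right _ _
    place-nonadj u v right left  e e' _ = trans (Graph.sym Joinˢ _ _) (adj-left-right _ _)

  canonical-injective : ∀ u v → canonical u ≡ canonical v → u ≡ v
  canonical-injective u v = place-injective u v (side u) (side v) refl refl

  canonical-adj : ∀ u v → u ≢ v → crosses (side u) (side v) ≡ false →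
    Adj Joinˢ (canonical u) (canonical v) ≡ true
  canonical-adj u v = place-adj u v (side u) (side v) refl refl

  canonical-nonadj : ∀ u v → crosses (side u) (side v) ≡ true →
    Adj Joinˢ (canonical u) (canonical v) ≡ false
  canonical-nonadj u v = place-nonadj u v (side u) (side v) refl refl

-- Separations

record Separation {n} (G : Graph n) : Set where
  field
    side        : Fin n → Side
    no-crossing : ∀ u v → crosses (side u) (side v) ≡ true → Adj G u v ≡ false

  open Labelling side public

crosses-irrefl : ∀ c → crosses c c ≡ false
crosses-irrefl middle = refl
crosses-irrefl left   = refl
crosses-irrefl right  = refl

true≢false : true ≢ false
true≢false ()

module _ {n} {G : Graph n} (σ : Separation G) where

  open Separation σ

  private
    adj⇒≢ : ∀ {m} (H : Graph m) {u v} → Adj H u v ≡ true → u ≢ v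
    adj⇒≢ H {u} uv refl = true≢false (trans (sym uv) (irrefl H u))

    adj⇒¬crosses : ∀ u v → Adj G u v ≡ true → crosses (side u) (side v) ≡ false
    adj⇒¬crosses u v uv with crosses (side u) (side v) in c
    ... | false = refl
    ... | true  = ⊥-elim (true≢false (trans (sym uv) (no-crossing u v c)))

  separation⇒≲ : G ≲ Joinˢ
  separation⇒≲ =
    mk↣ (canonical-injective _ _) , λ u v uv → canonical-adj u v (adj⇒≢ G uv) (adj⇒¬crosses u v uv)

  separation⇒≅ : (∀ u v → u ≢ v → crosses (side u) (side v) ≡ false → Adj G u v ≡ true) → G ≅ Joinˢ
  separation⇒≅ complete with injective⇒↔ (sym ∣∣ˢ-sum) canonical canonical-injective
  ... | e , to≡canonical =
    e , λ u v → trans (adj-equal u v) (sym (cong₂ (Adj Joinˢ) (to≡canonical u) (to≡canonical v)))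
    where
    adj-equal : ∀ u v → Adj G u v ≡ Adj Joinˢ (canonical u) (canonical v)
    adj-equal u v with Adj G u v in uv | Adj Joinˢ (canonical u) (canonical v) in φuv
    ... | false | false = refl
    ... | true  | true  = refl
    ... | true  | false = sym (trans (sym φuv) (proj₂ separation⇒≲ u v uv))
    ... | false | true  = trans (sym uv) (complete u v (λ u≡v → adj⇒≢ Joinˢ φuv (cong canonical u≡v)) ¬crosses)
      where
      ¬crosses : crosses (side u) (side v) ≡ false
      ¬crosses with crosses (side u) (side v) in c
      ... | false = refl
      ... | true  = ⊥-elim (true≢false (trans (sym φuv) (canonical-nonadj u v c)))

  crossing : Fin n → ℕ
  crossing u = count (λ v → crosses (side u) (side v))

  degree-bound : ∀ u → deg G u + crossing u < n
  degree-bound u = subst (_≤ n) (+-comm _ 1) (subst (λ d → d + crossing u + 1 ≤ n) (sym (deg≡count G u))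
    (count-disjoint-≤ (Adj G u) (λ v → crosses (side u) (side v)) u
      (irrefl G u) (crosses-irrefl (side u)) (adj⇒¬crosses u)))

  crossing-middle : ∀ u → side u ≡ middle → crossing u ≡ 0
  crossing-middle u e rewrite e = count-false n

  crossing-left : ∀ u → side u ≡ left → crossing u ≡ ∣ right ∣ˢ
  crossing-left u e rewrite e = sumF-cong λ v → cong 𝟙 (crosses-left (side v))
    where
    crosses-left : ∀ d → crosses left d ≡ (d == right)
    crosses-left middle = refl
    crosses-left left   = refl
    crosses-left right  = refl

  crossing-right : ∀ u → side u ≡ right → crossing u ≡ ∣ left ∣ˢ
  crossing-right u e rewrite e = sumF-cong λ v → cong 𝟙 (crosses-right (side v))
    where
    crosses-right : ∀ d → crosses right d ≡ (d == left)
    crosses-right middle = refl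
    crosses-right left   = refl
    crosses-right right  = refl

  sumF-crossing : sumF crossing ≡ 2 * (∣ left ∣ˢ * ∣ right ∣ˢ)
  sumF-crossing = begin
    sumF crossing
      ≡⟨ sumF-cong (λ u → crossing≡ u (side u) refl) ⟩
    sumF (λ u → 𝟙 (u ∈ˢ left) * ∣ right ∣ˢ + 𝟙 (u ∈ˢ right) * ∣ left ∣ˢ)
      ≡⟨ sumF-distrib-+ (λ u → 𝟙 (u ∈ˢ left) * ∣ right ∣ˢ) (λ u → 𝟙 (u ∈ˢ right) * ∣ left ∣ˢ) ⟩
    sumF (λ u → 𝟙 (u ∈ˢ left) * ∣ right ∣ˢ) + sumF (λ u → 𝟙 (u ∈ˢ right) * ∣ left ∣ˢ)
      ≡⟨ cong₂ _+_ (sumF-*ʳ (𝟙 ∘ (_∈ˢ left)) _) (sumF-*ʳ (𝟙 ∘ (_∈ˢ right)) _) ⟩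
    ∣ left ∣ˢ * ∣ right ∣ˢ + ∣ right ∣ˢ * ∣ left ∣ˢ
      ≡⟨ cong₂ _+_ refl (trans (*-comm ∣ right ∣ˢ ∣ left ∣ˢ) (sym (+-identityʳ _))) ⟩
    2 * (∣ left ∣ˢ * ∣ right ∣ˢ) ∎
    where
    open ≡-Reasoning
    weight : Side → ℕ
    weight d = 𝟙 (d == left) * ∣ right ∣ˢ + 𝟙 (d == right) * ∣ left ∣ˢ
    crossing≡ : ∀ u c → side u ≡ c → crossing u ≡ weight (side u)
    crossing≡ u middle e = trans (crossing-middle u e) (cong weight (sym e))
    crossing≡ u left   e = trans (crossing-left u e)
      (trans (sym (trans (+-identityʳ _) (+-identityʳ _))) (cong weight (sym e)))
    crossing≡ u right  e = trans (crossing-right u e) (trans (sym (+-identityʳ _)) (cong weight (sym e)))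

  private
    degree-bound′ : ∀ u → deg G u + crossing u ≤ n ∸ 1
    degree-bound′ u = m+n≤o⇒m≤o∸n _ (subst (_≤ n) (+-comm 1 _) (degree-bound u))

    Σdeg+crossing : sumF (λ u → deg G u + crossing u) ≡ 2 * size G + 2 * (∣ left ∣ˢ * ∣ right ∣ˢ)
    Σdeg+crossing = trans (sumF-distrib-+ (deg G) crossing) (cong₂ _+_ (handshake G) sumF-crossing)

    Σn∸1 : sumF {n} (λ _ → n ∸ 1) ≡ n * (n ∸ 1)
    Σn∸1 = sumF-const n (n ∸ 1)

  edge-bound : 2 * size G + 2 * (∣ left ∣ˢ * ∣ right ∣ˢ) ≤ n * (n ∸ 1)
  edge-bound = subst₂ _≤_ Σdeg+crossing Σn∸1 (sumF-mono-≤ degree-bound′)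

  edge-bound-strict : ∀ w → deg G w + crossing w < n ∸ 1 →
    2 * size G + 2 * (∣ left ∣ˢ * ∣ right ∣ˢ) < n * (n ∸ 1)
  edge-bound-strict w slack = subst₂ _<_ Σdeg+crossing Σn∸1 (sumF-mono-< degree-bound′ w slack)

  edge-bound-tight : n * (n ∸ 1) ≤ 2 * size G + 2 * (∣ left ∣ˢ * ∣ right ∣ˢ) → G ≅ Joinˢ
  edge-bound-tight tight = separation⇒≅ complete
    where
    saturated : ∀ u → deg G u + crossing u ≡ n ∸ 1
    saturated = sumF-mono-≤-tight degree-bound′ (subst₂ _≤_ (sym Σn∸1) (sym Σdeg+crossing) tight)

    n≤ : ∀ u → n ≤ count (Adj G u) + crossing u + 1
    n≤ u = begin
      n                                  ≤⟨ m≤n+m∸n n 1 ⟩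
      1 + (n ∸ 1)                        ≡⟨ +-comm 1 _ ⟩
      n ∸ 1 + 1                          ≡⟨ cong (_+ 1) (sym (saturated u)) ⟩
      deg G u + crossing u + 1           ≡⟨ cong (λ d → d + crossing u + 1) (deg≡count G u) ⟩
      count (Adj G u) + crossing u + 1   ∎
      where open ≤-Reasoning

    complete : ∀ u v → u ≢ v → crosses (side u) (side v) ≡ false → Adj G u v ≡ true
    complete u v u≢v = count-disjoint-tight (Adj G u) (λ w → crosses (side u) (side w)) u
      (irrefl G u) (crosses-irrefl (side u)) (adj⇒¬crosses u) (n≤ u) v (u≢v ∘ sym)

mirror : Side → Side
mirror middle = middle
mirror left   = right
mirror right  = left

mirror-== : ∀ c d → (mirror c == d) ≡ (c == mirror d)
mirror-== middle middle = refl
mirror-== middle left   = refl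
mirror-== middle right  = refl
mirror-== left   middle = refl
mirror-== left   left   = refl
mirror-== left   right  = refl
mirror-== right  middle = refl
mirror-== right  left   = refl
mirror-== right  right  = refl

crosses-mirror : ∀ c d → crosses (mirror c) (mirror d) ≡ crosses c d
crosses-mirror middle middle = refl
crosses-mirror middle left   = refl
crosses-mirror middle right  = refl
crosses-mirror left   middle = refl
crosses-mirror left   left   = refl
crosses-mirror left   right  = refl
crosses-mirror right  middle = refl
crosses-mirror right  left   = refl
crosses-mirror right  right  = refl

swap : ∀ {n} {G : Graph n} → Separation G → Separation G
swap σ = record
  { side        = mirror ∘ side
  ; no-crossing = λ u v c → no-crossing u v (trans (sym (crosses-mirror (side u) (side v))) c)
  }
  where open Separation σ

module _ {n} {G : Graph n} (σ : Separation G) where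

  private
    module σ = Separation σ
    module τ = Separation (swap σ)

    ∣∣ˢ-swap : ∀ c → τ.∣ c ∣ˢ ≡ σ.∣ mirror c ∣ˢ
    ∣∣ˢ-swap c = sumF-cong (λ u → cong 𝟙 (mirror-== (σ.side u) c))

  swap-middle : τ.∣ middle ∣ˢ ≡ σ.∣ middle ∣ˢ
  swap-middle = ∣∣ˢ-swap middle

  swap-left : τ.∣ left ∣ˢ ≡ σ.∣ right ∣ˢ
  swap-left = ∣∣ˢ-swap left

  swap-right : τ.∣ right ∣ˢ ≡ σ.∣ left ∣ˢ
  swap-right = ∣∣ˢ-swap right

resize-≲ : ∀ {n p q r p' q' r'} {G : Graph n} → p ≡ p' → q ≡ q' → r ≡ r' →
  G ≲ Join p q r → G ≲ Join p' q' r'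
resize-≲ refl refl refl G≲J = G≲J

demote : Bool → Side → Side
demote true  _ = middle
demote false c = c

crosses-demote : ∀ b c b' c' → crosses (demote b c) (demote b' c') ≡ true → crosses c c' ≡ true
crosses-demote false c      false c' h = h
crosses-demote false middle true  _  ()
crosses-demote false left   true  _  ()
crosses-demote false right  true  _  ()

𝟙-demote-middle : ∀ b c → (b ≡ true → c ≡ left) → 𝟙 (demote b c == middle) ≡ 𝟙 (c == middle) + 𝟙 b
𝟙-demote-middle false c _      = sym (+-identityʳ _)
𝟙-demote-middle true  c b⇒left rewrite b⇒left refl = refl

𝟙-demote-left : ∀ b c → (b ≡ true → c ≡ left) → 𝟙 (demote b c == left) + 𝟙 b ≡ 𝟙 (c == left)
𝟙-demote-left false c _      = +-identityʳ _
𝟙-demote-left true  c b⇒left rewrite b⇒left refl = refl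

𝟙-demote-right : ∀ b c → (b ≡ true → c ≡ left) → 𝟙 (demote b c == right) ≡ 𝟙 (c == right)
𝟙-demote-right false c _      = refl
𝟙-demote-right true  c b⇒left rewrite b⇒left refl = refl

module _ {n} {G : Graph n} (σ : Separation G) where

  open Separation σ

  separation⇒≲-enlarged : ∀ d → d ≤ ∣ left ∣ˢ → G ≲ Join (∣ middle ∣ˢ + d) (∣ left ∣ˢ ∸ d) ∣ right ∣ˢ
  separation⇒≲-enlarged d d≤ with choose-subset (_∈ˢ left) d d≤
  ... | Q , Q⊆left , ∣Q∣ = resize-≲ {G = G} ∣middle∣ ∣left∣ ∣right∣ (separation⇒≲ τ)
    where
    τ : Separation G
    τ = record
      { side        = λ u → demote (Q u) (side u)
      ; no-crossing = λ u v c → no-crossing u v (crosses-demote (Q u) (side u) (Q v) (side v) c)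
      }
    module τ = Separation τ
    Q⇒left : ∀ u → Q u ≡ true → side u ≡ left
    Q⇒left u Qu = ==⇒≡ (Q⊆left u Qu)
    ∣middle∣ : τ.∣ middle ∣ˢ ≡ ∣ middle ∣ˢ + d
    ∣middle∣ = trans (sumF-cong (λ u → 𝟙-demote-middle (Q u) (side u) (Q⇒left u)))
                     (trans (sumF-distrib-+ (𝟙 ∘ (_∈ˢ middle)) (𝟙 ∘ Q)) (cong (∣ middle ∣ˢ +_) ∣Q∣))
    ∣left∣ : τ.∣ left ∣ˢ ≡ ∣ left ∣ˢ ∸ d
    ∣left∣ = sym (+-cancelʳ-≡ d _ _ (begin
      ∣ left ∣ˢ ∸ d + d                ≡⟨ m∸n+n≡m d≤ ⟩
      ∣ left ∣ˢ                        ≡⟨ sumF-cong (λ u → sym (𝟙-demote-left (Q u) (side u) (Q⇒left u))) ⟩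
      sumF (λ u → 𝟙 (u τ.∈ˢ left) + 𝟙 (Q u)) ≡⟨ sumF-distrib-+ (𝟙 ∘ (τ._∈ˢ left)) (𝟙 ∘ Q) ⟩
      τ.∣ left ∣ˢ + count Q            ≡⟨ cong (τ.∣ left ∣ˢ +_) ∣Q∣ ⟩
      τ.∣ left ∣ˢ + d                  ∎))
      where open ≡-Reasoning
    ∣right∣ : τ.∣ right ∣ˢ ≡ ∣ right ∣ˢ
    ∣right∣ = sumF-cong (λ u → 𝟙-demote-right (Q u) (side u) (Q⇒left u))

module _ {n} (G : Graph n) (S : Subset n) {u₀ : Fin n} (reachable? : ∀ v → Dec (Walk G S u₀ v)) where

  private
    classify : ∀ {P : Set} → Bool → Dec P → Side
    classify true  _       = middle
    classify false (yes _) = left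
    classify false (no _)  = right

    side : Fin n → Side
    side v = classify (lookup S v) (reachable? v)

    unreached-neighbour : ∀ {x y} → Walk G S u₀ x → ¬ Walk G S u₀ y → lookup S y ≡ false →
      Adj G x y ≡ false
    unreached-neighbour {x} {y} x-reached y-unreached Sy with Adj G x y in xy
    ... | false = refl
    ... | true  = ⊥-elim (y-unreached (walk-snoc x-reached xy (∉-lookup Sy)))

    no-crossing : ∀ u v → crosses (side u) (side v) ≡ true → Adj G u v ≡ false
    no-crossing u v c with lookup S u in Su | reachable? u | lookup S v in Sv | reachable? v
    ... | false | yes u-reached | false | no  v-unreached = unreached-neighbour u-reached v-unreached Sv
    ... | false | no  u-unreached | false | yes v-reached =
      trans (Graph.sym G u v) (unreached-neighbour v-reached u-unreached Su)
    ... | true  | _     | _     | _     with () ← c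
    ... | false | yes _ | true  | _     with () ← c
    ... | false | yes _ | false | yes _ with () ← c
    ... | false | no  _ | true  | _     with () ← c
    ... | false | no  _ | false | no  _ with () ← c

  component-separation : Separation G
  component-separation = record { side = side ; no-crossing = no-crossing }

  open Separation component-separation using (∣_∣ˢ)

  component-middle : ∣ middle ∣ˢ ≡ ∣ S ∣
  component-middle = trans (sumF-cong λ v → classify-middle (lookup S v) (reachable? v)) (sym (∣S∣≡count S))
    where
    classify-middle : ∀ {P : Set} b (P? : Dec P) → 𝟙 (classify b P? == middle) ≡ 𝟙 b
    classify-middle true  _       = refl
    classify-middle false (yes _) = refl
    classify-middle false (no _)  = refl

  component-left : u₀ ∉ S → side u₀ ≡ left
  component-left u₀∉S rewrite lookup-∉ u₀∉S with reachable? u₀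
  ... | yes _ = refl
  ... | no u₀-unreached = ⊥-elim (u₀-unreached here)

  component-right : ∀ {v} → v ∉ S → ¬ Walk G S u₀ v → side v ≡ right
  component-right {v} v∉S v-unreached rewrite lookup-∉ v∉S with reachable? v
  ... | yes v-reached = ⊥-elim (v-unreached v-reached)
  ... | no _ = refl

-- Arithmetic of the shore sizes

shore-size : ∀ {d s x y} → d + y < s + (x + y) → d + 1 ≤ s + x
shore-size {d} {s} {x} {y} d+y<n = +-cancelʳ-≤ y (d + 1) (s + x) (begin
  d + 1 + y     ≡⟨ solve (d ∷ y ∷ []) ⟩
  suc (d + y)   ≤⟨ d+y<n ⟩
  s + (x + y)   ≡⟨ sym (+-assoc s x y) ⟩
  s + x + y     ∎)
  where open ≤-Reasoning

shore-slack : ∀ {d s x y} → d + 2 ≤ s + x → d + y < s + (x + y) ∸ 1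
shore-slack {d} {s} {x} {y} d+2≤ = m+n≤o⇒m≤o∸n _ (begin
  suc (d + y) + 1   ≡⟨ solve (d ∷ y ∷ []) ⟩
  d + 2 + y         ≤⟨ +-monoˡ-≤ y d+2≤ ⟩
  s + x + y         ≡⟨ +-assoc s x y ⟩
  s + (x + y)       ∎)
  where open ≤-Reasoning

∸-≡ : ∀ {a b c} → b + c ≡ a → a ∸ b ≡ c
∸-≡ {b = b} {c} refl = m+n∸m≡n b c

product-expansion : ∀ t e p q →
  t * (t + e + p + q) + (e * (t + e + p + q) + p * q) ≡ (t + e + p) * (t + e + q)
product-expansion = solve-∀

excess-zero : ∀ t e p q → 1 ≤ t → (t + e + p) * (t + e + q) ≤ t * (t + e + p + q) →
  e ≡ 0 × (p ≡ 0 ⊎ q ≡ 0)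
excess-zero t e p q 1≤t xy≤tN =
  e≡0 (m*n≡0⇒m≡0∨n≡0 e (m+n≡0⇒m≡0 (e * N) excess≡0)) ,
  m*n≡0⇒m≡0∨n≡0 p (m+n≡0⇒n≡0 (e * N) excess≡0)
  where
  N : ℕ
  N = t + e + p + q
  excess≡0 : e * N + p * q ≡ 0
  excess≡0 = n≤0⇒n≡0 (+-cancelˡ-≤ (t * N) _ 0 (begin
    t * N + (e * N + p * q)    ≡⟨ product-expansion t e p q ⟩
    (t + e + p) * (t + e + q)  ≤⟨ xy≤tN ⟩
    t * N                      ≡⟨ sym (+-identityʳ _) ⟩
    t * N + 0                  ∎))
    where open ≤-Reasoning
  e≡0 : e ≡ 0 ⊎ N ≡ 0 → e ≡ 0
  e≡0 (inj₁ e≡0) = e≡0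
  e≡0 (inj₂ N≡0) = ⊥-elim (<⇒≢ (≤-trans 1≤t t≤N) (sym N≡0))
    where
    t≤N : t ≤ N
    t≤N = ≤-trans (m≤m+n t e) (≤-trans (m≤m+n _ p) (m≤m+n _ q))

module _ (s e f : ℕ) where

  -- Throughout, k = 1 + s + e and δ = k + f, so that δ - k + 2 = f + 2.

  t≡ : suc s + e + f ∸ (suc s + e) + 2 ≡ f + 2
  t≡ = cong (_+ 2) (m+n∸m≡n (suc s + e) f)

  shore-lower-bound : ∀ {c x} → suc s + e + f + c ≤ s + x → f + (c + 1) + e ≤ x
  shore-lower-bound {c} {x} δ+c≤ = +-cancelˡ-≤ s _ _ (begin
    s + (f + (c + 1) + e)   ≡⟨ solve (s ∷ e ∷ f ∷ c ∷ []) ⟩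
    suc s + e + f + c       ≤⟨ δ+c≤ ⟩
    s + x                   ∎)
    where open ≤-Reasoning

  N≡ : ∀ p q → s + ((f + 2 + e + p) + (f + 2 + e + q)) ∸ (suc s + e + f) ∸ 1 ≡ f + 2 + e + p + q
  N≡ p q = trans (∸-+-assoc (s + ((f + 2 + e + p) + (f + 2 + e + q))) (suc s + e + f) 1) (∸-≡ split)
    where
    split : suc s + e + f + 1 + (f + 2 + e + p + q) ≡ s + ((f + 2 + e + p) + (f + 2 + e + q))
    split = solve (s ∷ e ∷ f ∷ p ∷ q ∷ [])

t≡-e≡0 : ∀ s f → suc s + 0 + f ∸ (suc s + 0) + 2 ≡ f + 2 + 0 + 0
t≡-e≡0 s f = trans (t≡ s 0 f) (sym (trans (+-identityʳ _) (+-identityʳ _)))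

balanced-shores : ∀ {n s x y k δ} → n ≡ s + (x + y) → s < k → k ≤ δ →
  δ + 1 ≤ s + x → δ + 1 ≤ s + y → x * y ≤ (δ ∸ k + 2) * (n ∸ δ ∸ 1) →
  s ≡ k ∸ 1 × (x ≡ δ ∸ k + 2 × y ≡ n ∸ δ ∸ 1 ⊎ y ≡ δ ∸ k + 2 × x ≡ n ∸ δ ∸ 1)
balanced-shores {s = s} refl s<k k≤δ x-big y-big xy≤tN with m≤n⇒∃[o]m+o≡n s<k
... | e , refl with m≤n⇒∃[o]m+o≡n k≤δ
... | f , refl with m≤n⇒∃[o]m+o≡n (shore-lower-bound s e f x-big) | m≤n⇒∃[o]m+o≡n (shore-lower-bound s e f y-big)
... | p , refl | q , refl
  with excess-zero (f + 2) e p q (≤-trans (s≤s z≤n) (m≤n+m 2 f))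
         (subst₂ (λ t N → (f + 2 + e + p) * (f + 2 + e + q) ≤ t * N) (t≡ s e f) (N≡ s e f p q) xy≤tN)
... | refl , inj₁ refl =
  sym (+-identityʳ s) , inj₁ (sym (t≡-e≡0 s f) , sym (trans (N≡ s 0 f 0 q) (cong (_+ q) (+-identityʳ _))))
... | refl , inj₂ refl =
  sym (+-identityʳ s) , inj₂ (sym (t≡-e≡0 s f) , sym (trans (N≡ s 0 f p 0) (+-identityʳ _)))


unbalanced-shores-impossible : ∀ {n s x y k δ} → n ≡ s + (x + y) → s < k → k ≤ δ →
  δ + 2 ≤ s + x → δ + 2 ≤ s + y → (k + 1) * (δ ∸ k + 2) + 2 * (δ + 2) ≤ 2 * n →
  2 * (x * y) < (δ ∸ k + 2) * (2 * n + k ∸ 2 * δ ∸ 3) → ⊥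
unbalanced-shores-impossible {s = s} refl s<k k≤δ x-big y-big h₁ h₂ with m≤n⇒∃[o]m+o≡n s<k
... | e , refl with m≤n⇒∃[o]m+o≡n k≤δ
... | f , refl with m≤n⇒∃[o]m+o≡n (shore-lower-bound s e f x-big) | m≤n⇒∃[o]m+o≡n (shore-lower-bound s e f y-big)
... | p , refl | q , refl = m+1+n≰m R (begin
    R + suc (2 * (e * (e + f + p + q + 3) + p * q))   ≡⟨ excess ⟩
    L₁ + suc L₂                                       ≤⟨ +-mono-≤ h₁′ h₂′ ⟩
    R                                                 ∎)
  where
  open ≤-Reasoning
  k δ x y n M L₁ L₂ R : ℕ
  k = suc s + e
  δ = k + f
  x = f + 3 + e + p
  y = f + 3 + e + q
  n = s + (x + y)
  M = s + 3 * e + 2 * f + 2 * p + 2 * q + 8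
  L₁ = (k + 1) * (f + 2) + 2 * (δ + 2)
  L₂ = 2 * (x * y)
  R = 2 * n + (f + 2) * M
  M≡ : 2 * n + k ∸ 2 * δ ∸ 3 ≡ M
  M≡ = trans (∸-+-assoc (2 * n + k) (2 * δ) 3) (∸-≡ split)
    where
    split : 2 * (suc s + e + f) + 3 + (s + 3 * e + 2 * f + 2 * p + 2 * q + 8)
          ≡ 2 * (s + ((f + 3 + e + p) + (f + 3 + e + q))) + (suc s + e)
    split = solve (s ∷ e ∷ f ∷ p ∷ q ∷ [])
  h₁′ : L₁ ≤ 2 * n
  h₁′ = subst (λ t → (k + 1) * t + 2 * (δ + 2) ≤ 2 * n) (t≡ s e f) h₁
  h₂′ : suc L₂ ≤ (f + 2) * M
  h₂′ = subst₂ (λ t M → suc L₂ ≤ t * M) (t≡ s e f) M≡ h₂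
  excess : 2 * (s + ((f + 3 + e + p) + (f + 3 + e + q))) + (f + 2) * (s + 3 * e + 2 * f + 2 * p + 2 * q + 8)
           + suc (2 * (e * (e + f + p + q + 3) + p * q))
         ≡ (suc s + e + 1) * (f + 2) + 2 * (suc s + e + f + 2) + suc (2 * ((f + 3 + e + p) * (f + 3 + e + q)))
  excess = solve (s ∷ e ∷ f ∷ p ∷ q ∷ [])

tight-shore : ∀ {n s x y k δ} → n ≡ s + (x + y) → s < k → k ≤ δ → s + x ≡ δ + 1 →
  Σ ℕ λ d → d ≤ x × s + d ≡ k ∸ 1 × x ∸ d ≡ δ ∸ k + 2 × y ≡ n ∸ δ ∸ 1
tight-shore {s = s} {x} {y} refl s<k k≤δ s+x≡δ+1 with m≤n⇒∃[o]m+o≡n s<k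
... | e , refl with m≤n⇒∃[o]m+o≡n k≤δ
... | f , refl with +-cancelˡ-≡ s x (f + 2 + e) (trans s+x≡δ+1 (solve (s ∷ e ∷ f ∷ [])))
... | refl = e , m≤n+m e (f + 2) , refl , trans (m+n∸n≡m (f + 2) e) (sym (t≡ s e f)) , sym N≡y
  where
  N≡y : s + ((f + 2 + e) + y) ∸ (suc s + e + f) ∸ 1 ≡ y
  N≡y = trans (∸-+-assoc (s + ((f + 2 + e) + y)) (suc s + e + f) 1) (∸-≡ split)
    where
    split : suc s + e + f + 1 + y ≡ s + ((f + 2 + e) + y)
    split = solve (s ∷ e ∷ f ∷ y ∷ [])

module _ {n} {G : Graph n} (σ : Separation G) {δ} (δ≤deg : ∀ u → δ ≤ deg G u) where

  open Separation σ

  shore-bound : ∀ u → side u ≡ left → δ + 1 ≤ ∣ middle ∣ˢ + ∣ left ∣ˢ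
  shore-bound u u∈left = shore-size {s = ∣ middle ∣ˢ} {x = ∣ left ∣ˢ} (begin-strict
    δ + ∣ right ∣ˢ          ≤⟨ +-mono-≤ (δ≤deg u) (≤-reflexive (sym (crossing-left σ u u∈left))) ⟩
    deg G u + crossing σ u  <⟨ degree-bound σ u ⟩
    n                       ≡⟨ sym ∣∣ˢ-sum ⟩
    ∣ middle ∣ˢ + (∣ left ∣ˢ + ∣ right ∣ˢ) ∎)
    where open ≤-Reasoning

shore-bound-right : ∀ {n} {G : Graph n} (σ : Separation G) {δ} → (∀ u → δ ≤ deg G u) →
  ∀ v → Separation.side σ v ≡ right → δ + 1 ≤ Separation.∣ σ ∣ˢ middle + Separation.∣ σ ∣ˢ right
shore-bound-right σ {δ} δ≤deg v v∈right = subst (δ + 1 ≤_) (cong₂ _+_ (swap-middle σ) (swap-left σ))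
  (shore-bound (swap σ) δ≤deg v (cong mirror v∈right))

module _ {n} {G : Graph n} (σ : Separation G) where

  open Separation σ

  separation⇒≅-sized : ∀ {p q r} → ∣ middle ∣ˢ ≡ p → ∣ left ∣ˢ ≡ q → ∣ right ∣ˢ ≡ r →
    n * (n ∸ 1) ≤ 2 * size G + 2 * (q * r) → G ≅ Join p q r
  separation⇒≅-sized refl refl refl tight = edge-bound-tight σ tight

  tight-shore⇒≲ : ∀ {k δ} → ∣ middle ∣ˢ < k → k ≤ δ → ∣ middle ∣ˢ + ∣ left ∣ˢ ≡ δ + 1 →
    G ≲ Join (k ∸ 1) (δ ∸ k + 2) (n ∸ δ ∸ 1)
  tight-shore⇒≲ s<k k≤δ s+x≡δ+1 with tight-shore (sym ∣∣ˢ-sum) s<k k≤δ s+x≡δ+1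
  ... | d , d≤x , s+d≡ , x∸d≡ , y≡ = resize-≲ {G = G} s+d≡ x∸d≡ y≡ (separation⇒≲-enlarged σ d d≤x)

  private
    slack-left : ∀ {d} → d + 2 ≤ ∣ middle ∣ˢ + ∣ left ∣ˢ → d + ∣ right ∣ˢ < n ∸ 1
    slack-left {d} d+2≤ = subst (λ m → d + ∣ right ∣ˢ < m ∸ 1) ∣∣ˢ-sum
      (shore-slack {s = ∣ middle ∣ˢ} {x = ∣ left ∣ˢ} {y = ∣ right ∣ˢ} d+2≤)

    slack-right : ∀ {d} → d + 2 ≤ ∣ middle ∣ˢ + ∣ right ∣ˢ → d + ∣ left ∣ˢ < n ∸ 1
    slack-right {d} d+2≤ = subst (λ m → d + ∣ left ∣ˢ < m ∸ 1)
      (trans (cong (∣ middle ∣ˢ +_) (+-comm ∣ right ∣ˢ ∣ left ∣ˢ)) ∣∣ˢ-sum)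
      (shore-slack {s = ∣ middle ∣ˢ} {x = ∣ right ∣ˢ} {y = ∣ left ∣ˢ} d+2≤)

  min-degree-slack : ∀ {δ w} → deg G w ≡ δ → δ + 2 ≤ ∣ middle ∣ˢ + ∣ left ∣ˢ →
    δ + 2 ≤ ∣ middle ∣ˢ + ∣ right ∣ˢ → deg G w + crossing σ w < n ∸ 1
  min-degree-slack {δ} {w} refl x-large y-large = by-side (side w) refl
    where
    by-side : ∀ c → side w ≡ c → deg G w + crossing σ w < n ∸ 1
    by-side middle w-side = begin-strict
      deg G w + crossing σ w     ≡⟨ cong (deg G w +_) (crossing-middle σ w w-side) ⟩
      deg G w + 0                ≤⟨ +-monoʳ-≤ (deg G w) z≤n ⟩
      deg G w + ∣ right ∣ˢ       <⟨ slack-left x-large ⟩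
      n ∸ 1                      ∎
      where open ≤-Reasoning
    by-side left  w-side = subst (λ c → deg G w + c < n ∸ 1) (sym (crossing-left σ w w-side)) (slack-left x-large)
    by-side right w-side = subst (λ c → deg G w + c < n ∸ 1) (sym (crossing-right σ w w-side)) (slack-right y-large)

record SmallSeparation {n} (G : Graph n) (δ k : ℕ) : Set where
  field
    separation  : Separation G
  open Separation separation public
  field
    middle<k    : ∣ middle ∣ˢ < k
    left-shore  : δ + 1 ≤ ∣ middle ∣ˢ + ∣ left ∣ˢ
    right-shore : δ + 1 ≤ ∣ middle ∣ˢ + ∣ right ∣ˢ

module _ {n} {G : Graph n} {δ κ k : ℕ} (δ≤deg : ∀ u → δ ≤ deg G u) (w : Fin n) (deg-w : deg G w ≡ δ)
         (k≤δ : k ≤ δ) where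

  small-cut : IsVertexConnectivity G κ → κ < k → Σ (Subset n) λ S → Disconnects G S × ∣ S ∣ ≡ κ
  small-cut (inj₁ (_ , κ≡n∸1)) κ<k = ⊥-elim (<⇒≱ κ<k (begin
    k        ≤⟨ k≤δ ⟩
    δ        ≡⟨ sym deg-w ⟩
    deg G w  ≤⟨ deg≤n∸1 G w ⟩
    n ∸ 1    ≡⟨ sym κ≡n∸1 ⟩
    κ        ∎))
    where open ≤-Reasoning
  small-cut (inj₂ (_ , cut , _)) _ = cut

  -- Reachability in G - S need not be decidable, but since the goal is ⊥ we may assume it is.
  small-separation : IsVertexConnectivity G κ → κ < k → ¬ ¬ SmallSeparation G δ k
  small-separation κ-conn κ<k ¬small with small-cut κ-conn κ<k
  ... | S , (u₀ , v₀ , u₀∉S , v₀∉S , v₀-unreached) , ∣S∣≡κ =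
    ¬¬-decidable (Walk G S u₀) λ reachable? → ¬small (small reachable?)
    where
    small : (∀ v → Dec (Walk G S u₀ v)) → SmallSeparation G δ k
    small reachable? = record
      { separation  = σ
      ; middle<k    = subst (_< k) (sym (trans (component-middle G S reachable?) ∣S∣≡κ)) κ<k
      ; left-shore  = shore-bound σ δ≤deg u₀ (component-left G S reachable? u₀∉S)
      ; right-shore = shore-bound-right σ δ≤deg v₀ (component-right G S reachable? v₀∉S v₀-unreached)
      }
      where
      σ : Separation G
      σ = component-separation G S reachable?

module _ {n} {G : Graph n} {δ k : ℕ} (k≤δ : k ≤ δ) (ς : SmallSeparation G δ k) where

  open SmallSeparation ς

  refute-a : n * (n ∸ 1) ≤ 2 * size G + 2 * ((δ ∸ k + 2) * (n ∸ δ ∸ 1)) →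
             ¬ (G ≅ Join (k ∸ 1) (δ ∸ k + 2) (n ∸ δ ∸ 1)) → ⊥
  refute-a dense ¬iso with balanced-shores (sym ∣∣ˢ-sum) middle<k k≤δ left-shore right-shore xy≤tN
    where
    xy≤tN : ∣ left ∣ˢ * ∣ right ∣ˢ ≤ (δ ∸ k + 2) * (n ∸ δ ∸ 1)
    xy≤tN = *-cancelˡ-≤ 2 (+-cancelˡ-≤ (2 * size G) _ _ (≤-trans (edge-bound separation) dense))
  ... | s≡ , inj₁ (x≡t , y≡N) = ¬iso (separation⇒≅-sized separation s≡ x≡t y≡N dense)
  ... | s≡ , inj₂ (y≡t , x≡N) = ¬iso (separation⇒≅-sized (swap separation)
    (trans (swap-middle separation) s≡) (trans (swap-left separation) y≡t) (trans (swap-right separation) x≡N) dense)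

  refute-b : ∀ {w} → deg G w ≡ δ →
             (k + 1) * (δ ∸ k + 2) + 2 * (δ + 2) ≤ 2 * n →
             n * (n ∸ 1) ≤ 2 * size G + (δ ∸ k + 2) * (2 * n + k ∸ 2 * δ ∸ 3) →
             ¬ (G ≲ Join (k ∸ 1) (δ ∸ k + 2) (n ∸ δ ∸ 1)) → ⊥
  refute-b {w} deg-w large dense ¬emb with m≤n⇒m<n∨m≡n left-shore | m≤n⇒m<n∨m≡n right-shore
  ... | inj₂ x-tight | _            = ¬emb (tight-shore⇒≲ separation middle<k k≤δ (sym x-tight))
  ... | inj₁ _       | inj₂ y-tight = ¬emb (tight-shore⇒≲ (swap separation)
    (subst (_< k) (sym (swap-middle separation)) middle<k) k≤δ
    (trans (cong₂ _+_ (swap-middle separation) (swap-left separation)) (sym y-tight)))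
  ... | inj₁ x-large | inj₁ y-large =
    unbalanced-shores-impossible (sym ∣∣ˢ-sum) middle<k k≤δ x-large′ y-large′ large
      (+-cancelˡ-< (2 * size G) _ _
        (<-≤-trans (edge-bound-strict separation w (min-degree-slack separation deg-w x-large′ y-large′)) dense))
    where
    x-large′ : δ + 2 ≤ ∣ middle ∣ˢ + ∣ left ∣ˢ
    x-large′ = subst (_≤ ∣ middle ∣ˢ + ∣ left ∣ˢ) (sym (+-suc δ 1)) x-large
    y-large′ : δ + 2 ≤ ∣ middle ∣ˢ + ∣ right ∣ˢ
    y-large′ = subst (_≤ ∣ middle ∣ˢ + ∣ right ∣ˢ) (sym (+-suc δ 1)) y-large

theorem2p1 : (n : ℕ) (G : Graph n) (δ κ k : ℕ) →
    5 ≤ n → Connected G → IsMinDegree G δ → IsVertexConnectivity G κ →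
    2 ≤ k → k ≤ δ →
    -- (a)  m ≥ n(n-1)/2 - (δ-k+2)(n-δ-1), multiplied by 2
    (n * (n ∸ 1) ≤ 2 * size G + 2 * ((δ ∸ k + 2) * (n ∸ δ ∸ 1)) →
      ¬ (G ≅ (K (k ∸ 1) ∨ᴳ (K (δ ∸ k + 2) ∪ᴳ K (n ∸ δ ∸ 1)))) →
      k ≤ κ)
    ×
    -- (b)  n ≥ (k+1)(δ-k+2)/2 + (δ+2)  and
    --      m ≥ n(n-1)/2 - (δ-k+2)(2n-2δ+k-3)/2, both multiplied by 2
    ((k + 1) * (δ ∸ k + 2) + 2 * (δ + 2) ≤ 2 * n →
      n * (n ∸ 1) ≤ 2 * size G + (δ ∸ k + 2) * (2 * n + k ∸ 2 * δ ∸ 3) →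
      ¬ (G ≲ (K (k ∸ 1) ∨ᴳ (K (δ ∸ k + 2) ∪ᴳ K (n ∸ δ ∸ 1)))) →
      k ≤ κ)
theorem2p1 n G δ κ k _ _ (δ≤deg , w , deg-w) κ-conn _ k≤δ =
  (λ dense ¬iso → by-small-separation λ ς → refute-a k≤δ ς dense ¬iso) ,
  (λ large dense ¬emb → by-small-separation λ ς → refute-b k≤δ ς deg-w large dense ¬emb)
  where
  by-small-separation : (SmallSeparation G δ k → ⊥) → k ≤ κ
  by-small-separation refute = decidable-stable (k ≤? κ) λ k≰κ →
    small-separation δ≤deg w deg-w k≤δ κ-conn (≰⇒> k≰κ) refute
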